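{- For $1\le i\le 15$ let $P_i=\{2i-1,2i\}$ and $Q_i=\{30+2i-1,30+2i\}$, and let \[ \mathcal{B}=\{P_i\cup P_j\cup P_k:\ 1\le i<j<k\le 15\}\ \cup\ \{Q_i\cup Q_j\cup Q_k:\ 1\le i<j<k\le 15\}, \] a family of $910$ six-element subsets of $[60]=\{1,\dots,60\}$. Then for every $S\subset[60]$ with $|S|=6$ there exists $B\in\mathcal{B}$ with $|S\cap B|\ge 3$. Equivalently, every vertex of the Johnson graph $J(60,6)$ lies at Johnson distance at most $3$ from some element of $\mathcal{B}$, i.e. $\mathcal{B}$ has covering radius $3$ in $J(60,6)$.
   Context: The Johnson graph $J(60,6)$ has vertex set the $6$-subsets of $[60]$, two vertices adjacent when they differ in exactly one element; the Johnson distance between $6$-subsets $S,B$ is $d_J(S,B)=6-|S\cap B|$. -}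

module Defs where

open import Data.Nat using (ℕ; _+_; _*_; _≤_; s≤s; z≤n)
open import Data.Nat.Properties using (+-mono-≤; *-monoʳ-≤)
open import Data.Fin using (Fin; toℕ; fromℕ<; _<_)
open import Data.Fin.Properties using (toℕ<n)
open import Data.Fin.Subset using (Subset; _∪_; ⁅_⁆)
open import Data.Product using (∃; _×_)
open import Data.Sum using (_⊎_)
open import Relation.Binary.PropositionalEquality using (_≡_)
open import Relation.Nullary.Decidable using (True; toWitness)
open import Data.Nat using (_≤?_)

-- Ground set [60] = {1,…,60} is modelled by Fin 60; the element with paper
-- label m (1 ≤ m ≤ 60) is the index m − 1.  A subset of [60] is a Subset 60.
-- Paper's block index i ∈ {1..15} is modelled by i' = i − 1 ∈ Fin 15.

private
  bnd : (c t : ℕ) → True (c ≤? 31) → t Data.Nat.< 15 → c + 2 * t Data.Nat.< 60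
  bnd c t hc (s≤s ht) = +-mono-≤ (s≤s (toWitness hc)) (*-monoʳ-≤ 2 ht)

idx : (c : ℕ) → True (c ≤? 31) → Fin 15 → Fin 60
idx c hc i = fromℕ< (bnd c (toℕ i) hc (toℕ<n i))

P : Fin 15 → Subset 60
P i = ⁅ idx 0 _ i ⁆ ∪ ⁅ idx 1 _ i ⁆

Q : Fin 15 → Subset 60
Q i = ⁅ idx 30 _ i ⁆ ∪ ⁅ idx 31 _ i ⁆

_∈𝓑 : Subset 60 → Set
B ∈𝓑 =
  (∃ λ i → ∃ λ j → ∃ λ k → i < j × j < k × B ≡ P i ∪ P j ∪ P k)
  ⊎ (∃ λ i → ∃ λ j → ∃ λ k → i < j × j < k × B ≡ Q i ∪ Q j ∪ Q k)

-- One half of [60] contains at least three points of S, since |S| = 6.  Each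
-- half is the disjoint union of fifteen pairs, and three of these pairs can
-- always be chosen to cover three points of S: take pairs meeting S first,
-- and fill up with arbitrary pairs.  Their union is a block of 𝓑.
module Submission where

open import Defs
open import Data.Bool using (_∨_)
open import Data.Bool.Properties using (_≟_)
open import Data.Fin using (Fin; zero; suc; _<_)
open import Data.Fin.Properties using (all?)
open import Data.Fin.Subset
  using (Subset; ∣_∣; _∩_; _∪_; ⁅_⁆; ⊥; ⊤; inside; outside)
open import Data.Fin.Subset.Properties
  using (∣⊥∣≡0; ∣⊤∣≡n; ∩-identityʳ; ∪-identityˡ)
open import Data.Nat using (zero; suc; _+_; _*_; _⊓_; _≤_; z≤n; s≤s; _≤?_)
open import Data.Nat.Properties
  using (≤-trans; ≤-reflexive; ≤-antisym; ≤-pred; ≰⇒>; <⇒≢; +-mono-<; n≤1+n; m≤m+n; m≤n+m;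
         ⊓-monoˡ-≤; m⊓n≤n; m≤n⇒m⊓n≡m; suc-injective; module ≤-Reasoning)
open import Data.Product using (∃; _×_; _,_)
open import Data.Sum using (_⊎_; inj₁; inj₂)
open import Data.Vec using (_∷_; []; _++_; splitAt)
open import Data.Vec.Properties using (zipWith-++; ≡-dec)
open import Relation.Nullary using (yes; no; contradiction)
open import Relation.Nullary.Decidable using (from-yes)
open import Relation.Binary.PropositionalEquality
  using (_≡_; refl; sym; trans; cong; cong₂)

∣p++q∣≡∣p∣+∣q∣ : ∀ {m n} (p : Subset m) (q : Subset n) → ∣ p ++ q ∣ ≡ ∣ p ∣ + ∣ q ∣
∣p++q∣≡∣p∣+∣q∣ []            q = refl
∣p++q∣≡∣p∣+∣q∣ (inside  ∷ p) q = cong suc (∣p++q∣≡∣p∣+∣q∣ p q)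
∣p++q∣≡∣p∣+∣q∣ (outside ∷ p) q = ∣p++q∣≡∣p∣+∣q∣ p q

∣p++q∩r++s∣ : ∀ {m n} (p r : Subset m) (q s : Subset n) →
              ∣ (p ++ q) ∩ (r ++ s) ∣ ≡ ∣ p ∩ r ∣ + ∣ q ∩ s ∣
∣p++q∩r++s∣ p r q s = trans (cong ∣_∣ (zipWith-++ _ p q r s)) (∣p++q∣≡∣p∣+∣q∣ (p ∩ r) (q ∩ s))

∣p∣≡0⇒p≡⊥ : ∀ {n} (p : Subset n) → ∣ p ∣ ≡ 0 → p ≡ ⊥
∣p∣≡0⇒p≡⊥ []            _  = refl
∣p∣≡0⇒p≡⊥ (outside ∷ p) e  = cong (outside ∷_) (∣p∣≡0⇒p≡⊥ p e)

∣p∣≡1⇒⁅i⁆ : ∀ {n} (p : Subset n) → ∣ p ∣ ≡ 1 → ∃ λ i → p ≡ ⁅ i ⁆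
∣p∣≡1⇒⁅i⁆ (inside  ∷ p) e = zero , cong (inside ∷_) (∣p∣≡0⇒p≡⊥ p (suc-injective e))
∣p∣≡1⇒⁅i⁆ (outside ∷ p) e with ∣p∣≡1⇒⁅i⁆ p e
... | i , refl = suc i , refl

∣p∣≡2⇒⁅i⁆∪⁅j⁆ : ∀ {n} (p : Subset n) → ∣ p ∣ ≡ 2 →
                ∃ λ i → ∃ λ j → i < j × p ≡ ⁅ i ⁆ ∪ ⁅ j ⁆
∣p∣≡2⇒⁅i⁆∪⁅j⁆ (inside ∷ p) e with ∣p∣≡1⇒⁅i⁆ p (suc-injective e)
... | j , refl = zero , suc j , s≤s z≤n , cong (inside ∷_) (sym (∪-identityˡ ⁅ j ⁆))
∣p∣≡2⇒⁅i⁆∪⁅j⁆ (outside ∷ p) e with ∣p∣≡2⇒⁅i⁆∪⁅j⁆ p e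
... | i , j , i<j , refl = suc i , suc j , s≤s i<j , refl

∣p∣≡3⇒⁅i⁆∪⁅j⁆∪⁅k⁆ : ∀ {n} (p : Subset n) → ∣ p ∣ ≡ 3 →
                    ∃ λ i → ∃ λ j → ∃ λ k → i < j × j < k × p ≡ ⁅ i ⁆ ∪ ⁅ j ⁆ ∪ ⁅ k ⁆
∣p∣≡3⇒⁅i⁆∪⁅j⁆∪⁅k⁆ (inside ∷ p) e with ∣p∣≡2⇒⁅i⁆∪⁅j⁆ p (suc-injective e)
... | j , k , j<k , refl =
  zero , suc j , suc k , s≤s z≤n , s≤s j<k , cong (inside ∷_) (sym (∪-identityˡ (⁅ j ⁆ ∪ ⁅ k ⁆)))
∣p∣≡3⇒⁅i⁆∪⁅j⁆∪⁅k⁆ (outside ∷ p) e with ∣p∣≡3⇒⁅i⁆∪⁅j⁆∪⁅k⁆ p e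
... | i , j , k , i<j , j<k , refl = suc i , suc j , suc k , s≤s i<j , s≤s j<k , refl

pairs : ∀ {n} → Subset n → Subset (n * 2)
pairs []      = []
pairs (x ∷ p) = x ∷ x ∷ pairs p

pairs-∪ : ∀ {n} (p q : Subset n) → pairs (p ∪ q) ≡ pairs p ∪ pairs q
pairs-∪ []      []      = refl
pairs-∪ (x ∷ p) (y ∷ q) = cong (λ r → (x ∨ y) ∷ (x ∨ y) ∷ r) (pairs-∪ p q)

pairs-⊤ : ∀ n → pairs (⊤ {n}) ≡ ⊤
pairs-⊤ zero    = refl
pairs-⊤ (suc n) = cong (λ r → inside ∷ inside ∷ r) (pairs-⊤ n)

∪-hom⇒⁅i⁆∪⁅j⁆∪⁅k⁆ : ∀ {m n} (g : Subset m → Subset n) → (∀ p q → g (p ∪ q) ≡ g p ∪ g q) →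
                     ∀ i j k → g (⁅ i ⁆ ∪ ⁅ j ⁆ ∪ ⁅ k ⁆) ≡ g ⁅ i ⁆ ∪ g ⁅ j ⁆ ∪ g ⁅ k ⁆
∪-hom⇒⁅i⁆∪⁅j⁆∪⁅k⁆ g g-∪ i j k = trans (g-∪ ⁅ i ⁆ (⁅ j ⁆ ∪ ⁅ k ⁆)) (cong (g ⁅ i ⁆ ∪_) (g-∪ ⁅ j ⁆ ⁅ k ⁆))

-- A pair meeting p is always taken; an empty pair is skipped unless all the
-- remaining pairs are needed to reach m of them, in which case t = ⊤.
pairs-covering : ∀ {n} m → m ≤ n → (p : Subset (n * 2)) →
                 ∃ λ (t : Subset n) → ∣ t ∣ ≡ m × m ⊓ ∣ p ∣ ≤ ∣ p ∩ pairs t ∣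
pairs-covering {n} zero _ _ = ⊥ , ∣⊥∣≡0 n , z≤n
pairs-covering (suc m) (s≤s m≤n) (inside ∷ inside ∷ p) with pairs-covering m m≤n p
... | t , ∣t∣≡m , covers = inside ∷ t , cong suc ∣t∣≡m ,
  s≤s (≤-trans (⊓-monoˡ-≤ (suc ∣ p ∣) (n≤1+n m)) (s≤s covers))
pairs-covering (suc m) (s≤s m≤n) (inside ∷ outside ∷ p) with pairs-covering m m≤n p
... | t , ∣t∣≡m , covers = inside ∷ t , cong suc ∣t∣≡m , s≤s covers
pairs-covering (suc m) (s≤s m≤n) (outside ∷ inside ∷ p) with pairs-covering m m≤n p
... | t , ∣t∣≡m , covers = inside ∷ t , cong suc ∣t∣≡m , s≤s covers
pairs-covering {suc n} (suc m) (s≤s m≤n) (outside ∷ outside ∷ p) with suc m ≤? n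
... | yes m<n with pairs-covering (suc m) m<n p
...   | t , ∣t∣≡m , covers = outside ∷ t , ∣t∣≡m , covers
pairs-covering {suc n} (suc m) (s≤s m≤n) (outside ∷ outside ∷ p) | no m≮n
  with ≤-antisym m≤n (≤-pred (≰⇒> m≮n))
... | refl = ⊤ , ∣⊤∣≡n (suc m) , ≤-trans (m⊓n≤n (suc m) ∣ p ∣) (≤-reflexive (sym ∣p∩pairs⊤∣))
  where
  ∣p∩pairs⊤∣ : ∣ p ∩ pairs (⊤ {m}) ∣ ≡ ∣ p ∣
  ∣p∩pairs⊤∣ = cong ∣_∣ (trans (cong (p ∩_) (pairs-⊤ m)) (∩-identityʳ p))

m+n≡a+a⇒a≤m⊎a≤n : ∀ {a m n} → m + n ≡ a + a → a ≤ m ⊎ a ≤ n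
m+n≡a+a⇒a≤m⊎a≤n {a} {m} {n} m+n≡a+a with a ≤? m | a ≤? n
... | yes a≤m | _       = inj₁ a≤m
... | no _    | yes a≤n = inj₂ a≤n
... | no a≰m  | no a≰n  = contradiction m+n≡a+a (<⇒≢ (+-mono-< (≰⇒> a≰m) (≰⇒> a≰n)))

three-pairs-covering : ∀ {n} → 3 ≤ n → (p : Subset (n * 2)) → 3 ≤ ∣ p ∣ →
  ∃ λ i → ∃ λ j → ∃ λ k → i < j × j < k × 3 ≤ ∣ p ∩ pairs (⁅ i ⁆ ∪ ⁅ j ⁆ ∪ ⁅ k ⁆) ∣
three-pairs-covering 3≤n p 3≤∣p∣ with pairs-covering 3 3≤n p
... | t , ∣t∣≡3 , covers with ∣p∣≡3⇒⁅i⁆∪⁅j⁆∪⁅k⁆ t ∣t∣≡3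
... | i , j , k , i<j , j<k , refl =
  i , j , k , i<j , j<k , ≤-trans (≤-reflexive (sym (m≤n⇒m⊓n≡m 3≤∣p∣))) covers

leftPairs : Subset 15 → Subset 60
leftPairs t = pairs t ++ ⊥

rightPairs : Subset 15 → Subset 60
rightPairs t = ⊥ {30} ++ pairs t

leftPairs-∪ : ∀ p q → leftPairs (p ∪ q) ≡ leftPairs p ∪ leftPairs q
leftPairs-∪ p q =
  trans (cong (_++ ⊥) (pairs-∪ p q)) (sym (zipWith-++ _∨_ (pairs p) ⊥ (pairs q) ⊥))

rightPairs-∪ : ∀ p q → rightPairs (p ∪ q) ≡ rightPairs p ∪ rightPairs q
rightPairs-∪ p q =
  trans (cong (⊥ {30} ++_) (pairs-∪ p q)) (sym (zipWith-++ _∨_ (⊥ {30}) (pairs p) ⊥ (pairs q)))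

P≡leftPairs⁅i⁆ : ∀ i → P i ≡ leftPairs ⁅ i ⁆
P≡leftPairs⁅i⁆ = from-yes (all? λ i → ≡-dec _≟_ (P i) (leftPairs ⁅ i ⁆))

Q≡rightPairs⁅i⁆ : ∀ i → Q i ≡ rightPairs ⁅ i ⁆
Q≡rightPairs⁅i⁆ = from-yes (all? λ i → ≡-dec _≟_ (Q i) (rightPairs ⁅ i ⁆))

P-block : ∀ i j k → P i ∪ P j ∪ P k ≡ leftPairs (⁅ i ⁆ ∪ ⁅ j ⁆ ∪ ⁅ k ⁆)
P-block i j k =
  trans (cong₂ _∪_ (P≡leftPairs⁅i⁆ i) (cong₂ _∪_ (P≡leftPairs⁅i⁆ j) (P≡leftPairs⁅i⁆ k)))
        (sym (∪-hom⇒⁅i⁆∪⁅j⁆∪⁅k⁆ leftPairs leftPairs-∪ i j k))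

Q-block : ∀ i j k → Q i ∪ Q j ∪ Q k ≡ rightPairs (⁅ i ⁆ ∪ ⁅ j ⁆ ∪ ⁅ k ⁆)
Q-block i j k =
  trans (cong₂ _∪_ (Q≡rightPairs⁅i⁆ i) (cong₂ _∪_ (Q≡rightPairs⁅i⁆ j) (Q≡rightPairs⁅i⁆ k)))
        (sym (∪-hom⇒⁅i⁆∪⁅j⁆∪⁅k⁆ rightPairs rightPairs-∪ i j k))

module _ (xs ys : Subset 30) (i j k : Fin 15) where

  open ≤-Reasoning

  private
    t : Subset 15
    t = ⁅ i ⁆ ∪ ⁅ j ⁆ ∪ ⁅ k ⁆

  ∣xs∩pairs-t∣≤∣xs++ys∩P-block∣ : ∣ xs ∩ pairs t ∣ ≤ ∣ (xs ++ ys) ∩ (P i ∪ P j ∪ P k) ∣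
  ∣xs∩pairs-t∣≤∣xs++ys∩P-block∣ = begin
    ∣ xs ∩ pairs t ∣                    ≤⟨ m≤m+n _ _ ⟩
    ∣ xs ∩ pairs t ∣ + ∣ ys ∩ ⊥ ∣       ≡⟨ ∣p++q∩r++s∣ xs (pairs t) ys ⊥ ⟨
    ∣ (xs ++ ys) ∩ leftPairs t ∣        ≡⟨ cong (λ B → ∣ (xs ++ ys) ∩ B ∣) (P-block i j k) ⟨
    ∣ (xs ++ ys) ∩ (P i ∪ P j ∪ P k) ∣  ∎

  ∣ys∩pairs-t∣≤∣xs++ys∩Q-block∣ : ∣ ys ∩ pairs t ∣ ≤ ∣ (xs ++ ys) ∩ (Q i ∪ Q j ∪ Q k) ∣
  ∣ys∩pairs-t∣≤∣xs++ys∩Q-block∣ = begin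
    ∣ ys ∩ pairs t ∣                    ≤⟨ m≤n+m _ _ ⟩
    ∣ xs ∩ ⊥ ∣ + ∣ ys ∩ pairs t ∣       ≡⟨ ∣p++q∩r++s∣ xs ⊥ ys (pairs t) ⟨
    ∣ (xs ++ ys) ∩ rightPairs t ∣       ≡⟨ cong (λ B → ∣ (xs ++ ys) ∩ B ∣) (Q-block i j k) ⟨
    ∣ (xs ++ ys) ∩ (Q i ∪ Q j ∪ Q k) ∣  ∎

theorem1 : (S : Subset 60) → ∣ S ∣ ≡ 6 →
    ∃ λ (B : Subset 60) → B ∈𝓑 × 3 ≤ ∣ S ∩ B ∣
theorem1 S ∣S∣≡6 with splitAt 30 S
... | xs , ys , refl with m+n≡a+a⇒a≤m⊎a≤n (trans (sym (∣p++q∣≡∣p∣+∣q∣ xs ys)) ∣S∣≡6)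
... | inj₁ 3≤∣xs∣ with three-pairs-covering (m≤m+n 3 12) xs 3≤∣xs∣
...   | i , j , k , i<j , j<k , covers =
  P i ∪ P j ∪ P k , inj₁ (i , j , k , i<j , j<k , refl) ,
  ≤-trans covers (∣xs∩pairs-t∣≤∣xs++ys∩P-block∣ xs ys i j k)
theorem1 S ∣S∣≡6 | xs , ys , refl | inj₂ 3≤∣ys∣ with three-pairs-covering (m≤m+n 3 12) ys 3≤∣ys∣
...   | i , j , k , i<j , j<k , covers =
  Q i ∪ Q j ∪ Q k , inj₂ (i , j , k , i<j , j<k , refl) ,
  ≤-trans covers (∣ys∩pairs-t∣≤∣xs++ys∩Q-block∣ xs ys i j k)
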